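{- Let $\mathcal{F}\subseteq 2^{\{1,\dots,n\}}$ and $\mathcal{G}\subseteq 2^{\{1,\dots,m\}}$ be odd-sunflower-free families, and suppose $\mathcal{G}$ is an antichain. Then the wreath product $\mathcal{F}\wr\mathcal{G}$ is odd-sunflower-free. Moreover, if $\mathcal{F}$ is also an antichain, then so is $\mathcal{F}\wr\mathcal{G}$.
   Context: A family of at least two nonempty sets is an odd-sunflower if every element of the underlying set is contained in an odd number of its sets, or in none; a family is odd-sunflower-free if none of its subfamilies is an odd-sunflower. A family is an antichain if no member is a proper subset of another. Wreath product: take $n$ isomorphic copies $\mathcal{G}_1,\dots,\mathcal{G}_n$ of $\mathcal{G}$ on pairwise disjoint underlying sets $M_1,\dots,M_n$ (copies of $\{1,\dots,m\}$); then $\mathcal{F}\wr\mathcal{G}=\{\bigcup_{i\in F}G_i : F\in\mathcal{F},\ G_i\in\mathcal{G}_i \text{ for each } i\in F\}$, a family on $\bigcup_{i=1}^n M_i$. -}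

module Defs where

open import Data.Bool using (Bool; true; false; T)
open import Data.Nat using (ℕ; zero; suc; _≤_; _%_)
open import Data.Fin using (Fin)
open import Data.Fin.Subset using (Subset)
open import Data.Vec using (Vec; lookup; replicate)
open import Data.List using (List; []; _∷_; length)
open import Data.List.Relation.Unary.All using (All)
open import Data.List.Relation.Unary.Unique.Propositional using (Unique)
open import Data.Product using (_×_; ∃; ∃-syntax; _,_)
open import Data.Sum using (_⊎_)
open import Relation.Nullary using (¬_)
open import Relation.Binary.PropositionalEquality using (_≡_; _≢_)

-- Generic notions for families of sets: S is the type of sets, X the
-- underlying (ground) set, and mem x A says whether x ∈ A.
-- A family is a predicate on S (the sets belonging to it).
module Generic {X S : Set} (mem : X → S → Bool) where

  count : X → List S → ℕ
  count x []      = zero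
  count x (A ∷ L) with mem x A
  ... | true  = suc (count x L)
  ... | false = count x L

  Nonempty : S → Set
  Nonempty A = ∃[ x ] T (mem x A)

  IsOddSunflower : List S → Set
  IsOddSunflower L =
    2 ≤ length L × All Nonempty L × (∀ x → count x L ≡ 0 ⊎ count x L % 2 ≡ 1)

  -- No subfamily (finite collection of distinct members) is an odd-sunflower.
  OddSunflowerFree : (S → Set) → Set
  OddSunflowerFree 𝓕 = ∀ (L : List S) → Unique L → All 𝓕 L → ¬ IsOddSunflower L

  _⊆_ : S → S → Set
  A ⊆ B = ∀ x → T (mem x A) → T (mem x B)

  _⊂_ : S → S → Set
  A ⊂ B = A ⊆ B × A ≢ B

  Antichain : (S → Set) → Set
  Antichain 𝓕 = ∀ A B → 𝓕 A → 𝓕 B → ¬ (A ⊂ B)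

memFin : ∀ {n} → Fin n → Subset n → Bool
memFin i A = lookup A i

-- Sets over the disjoint union M_1 ∪ … ∪ M_n of n copies of {1..m}
-- (ground set Fin n × Fin m): a set is given by its n traces, one per copy.
WSet : ℕ → ℕ → Set
WSet n m = Vec (Subset m) n

memW : ∀ {n m} → Fin n × Fin m → WSet n m → Bool
memW (i , j) A = lookup (lookup A i) j

emptySet : ∀ {m} → Subset m
emptySet = replicate _ false

Wreath : ∀ {n m} → (Subset n → Set) → (Subset m → Set) → WSet n m → Set
Wreath {n} 𝓕 𝓖 A = ∃[ F₀ ] (𝓕 F₀ × (∀ (i : Fin n) →
  (T (lookup F₀ i) → 𝓖 (lookup A i)) × (¬ T (lookup F₀ i) → lookup A i ≡ emptySet)))

module Submission where

-- If ∅ ∈ 𝓖, the antichain 𝓖 is {∅} and every member of 𝓕 ≀ 𝓖 is empty. Otherwise the witness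
-- F₀ of A ∈ 𝓕 ≀ 𝓖 is forced to be the support {i | Aᵢ ≠ ∅} of A. Given an odd-sunflower 𝓐 in
-- 𝓕 ≀ 𝓖 and a copy i, the nonempty traces Aᵢ (A ∈ 𝓐), counted with multiplicity, cover each point
-- zero or an odd number of times. Such a multifamily from an odd-sunflower-free antichain is empty or
-- an odd number of copies of one set: without repetitions it has at most one member, and if G is
-- repeated, dropping two copies leaves (by induction) copies of some H covering every point of G,
-- so G ⊆ H and G = H. Hence each i lies in zero or an odd number of supports, and members of 𝓐
-- with equal supports coincide, so the supports form an odd-sunflower in 𝓕. For the antichain
-- part, A ⊆ B makes the supports comparable and then each pair of fibres comparable.

open import Defs
open import Data.Bool using (Bool; true; false; T)
open import Data.Bool.Properties using (T?) renaming (_≟_ to _≟ᴮ_)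
open import Data.Nat using (ℕ; zero; suc; _≤_; _<_; _%_; s≤s; z≤n)
open import Data.Nat.Properties using (n<1+n; m<n⇒m<1+n)
open import Data.Nat.Induction using (<-wellFounded)
open import Data.Fin using (Fin; zero; suc)
open import Data.Fin.Subset using (Subset)
open import Data.Vec using (Vec; []; _∷_; lookup; tabulate)
open import Data.Vec.Properties
  using (≡-dec; lookup-replicate; lookup∘tabulate; tabulate∘lookup; tabulate-cong)
open import Data.List using (List; []; _∷_; length; map)
open import Data.List.Properties using (length-map)
open import Data.List.Relation.Unary.All as All using (All; []; _∷_)
open import Data.List.Relation.Unary.All.Properties as Allₚ using (¬Any⇒All¬)
open import Data.List.Relation.Unary.Any using (here; there)
open import Data.List.Relation.Unary.AllPairs using ([]; _∷_)
open import Data.List.Relation.Unary.Unique.Propositional using (Unique)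
open import Data.List.Membership.Propositional using (_∈_)
open import Data.List.Membership.Propositional.Properties using (∈-∃++)
import Data.List.Membership.DecPropositional as DecMembership
open import Data.List.Relation.Binary.Permutation.Propositional
  using (_↭_; prep; swap; trans; ↭-sym) renaming (refl to ↭-refl)
open import Data.List.Relation.Binary.Permutation.Propositional.Properties
  using (shift; ↭-length; All-resp-↭; ∈-resp-↭)
open import Data.Product using (_×_; ∃; ∃₂; _,_; proj₁; proj₂)
open import Data.Sum using (_⊎_; inj₁; inj₂; [_,_]′)
open import Data.Empty using (⊥-elim)
open import Data.Unit using (tt)
open import Relation.Nullary using (¬_; yes; no; isNo; ¬¬-excluded-middle)
open import Induction.WellFounded using (Acc; acc)
open import Relation.Binary.Definitions using (DecidableEquality)
open import Relation.Binary.PropositionalEquality using (_≡_; _≢_; refl; sym; cong; subst)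
  renaming (trans to ≡-trans)

map⁺-injectiveOn : ∀ {A B : Set} {f : A → B} {xs : List A} →
  (∀ {x y} → x ∈ xs → y ∈ xs → f x ≡ f y → x ≡ y) → Unique xs → Unique (map f xs)
map⁺-injectiveOn {xs = []}     _   []        = []
map⁺-injectiveOn {xs = x ∷ xs} inj (x∉ ∷ u) =
  Allₚ.map⁺ (All.tabulate λ y∈xs fx≡fy → All.lookup x∉ y∈xs (inj (here refl) (there y∈xs) fx≡fy))
  ∷ map⁺-injectiveOn (λ x∈ y∈ → inj (there x∈) (there y∈)) u

lookup-ext : ∀ {A : Set} {k} {u v : Vec A k} → (∀ i → lookup u i ≡ lookup v i) → u ≡ v
lookup-ext {u = u} {v} u≗v =
  ≡-trans (sym (tabulate∘lookup u)) (≡-trans (tabulate-cong u≗v) (tabulate∘lookup v))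

ZeroOrOdd : ℕ → Set
ZeroOrOdd c = c ≡ 0 ⊎ c % 2 ≡ 1

module Families {X S : Set} (mem : X → S → Bool) where
  open Generic mem

  OddCounts : List S → Set
  OddCounts L = ∀ x → ZeroOrOdd (count x L)

  Constant : List S → Set
  Constant L = ∀ {A B} → A ∈ L → B ∈ L → A ≡ B

  count-resp-↭ : ∀ x {L L′} → L ↭ L′ → count x L ≡ count x L′
  count-resp-↭ x ↭-refl = refl
  count-resp-↭ x (prep A p) with mem x A
  ... | true  = cong suc (count-resp-↭ x p)
  ... | false = count-resp-↭ x p
  count-resp-↭ x (swap A B p) with mem x A in x∈A | mem x B in x∈B
  ... | true  | true  rewrite x∈A | x∈B = cong (λ c → suc (suc c)) (count-resp-↭ x p)
  ... | true  | false rewrite x∈A | x∈B = cong suc (count-resp-↭ x p)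
  ... | false | true  rewrite x∈A | x∈B = cong suc (count-resp-↭ x p)
  ... | false | false rewrite x∈A | x∈B = count-resp-↭ x p
  count-resp-↭ x (trans p q) = ≡-trans (count-resp-↭ x p) (count-resp-↭ x q)

  covered-if-count≢0 : ∀ x L → count x L ≢ 0 → ∃ λ A → A ∈ L × T (mem x A)
  covered-if-count≢0 x []      c≢0 = ⊥-elim (c≢0 refl)
  covered-if-count≢0 x (A ∷ L) c≢0 with mem x A in x∈A
  ... | true  = A , here refl , subst T (sym x∈A) tt
  ... | false with covered-if-count≢0 x L c≢0
  ...   | B , B∈L , x∈B = B , there B∈L , x∈B

  oddCounts-resp-↭ : ∀ {L L′} → L ↭ L′ → OddCounts L → OddCounts L′
  oddCounts-resp-↭ p oc x = subst ZeroOrOdd (count-resp-↭ x p) (oc x)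

  constant-resp-↭ : ∀ {L L′} → L ↭ L′ → Constant L → Constant L′
  constant-resp-↭ p c A∈ B∈ = c (∈-resp-↭ (↭-sym p) A∈) (∈-resp-↭ (↭-sym p) B∈)

  count-∷-∈ : ∀ {x A} L → mem x A ≡ true → count x (A ∷ L) ≡ suc (count x L)
  count-∷-∈ L x∈A rewrite x∈A = refl

  count-∷-∉ : ∀ {x A} L → mem x A ≡ false → count x (A ∷ L) ≡ count x L
  count-∷-∉ L x∉A rewrite x∉A = refl

  count-odd-under-pair : ∀ G L → OddCounts (G ∷ G ∷ L) → ∀ x → T (mem x G) → count x L % 2 ≡ 1
  count-odd-under-pair G L oc x x∈G with mem x G in x∈G′
  ... | true with subst ZeroOrOdd (≡-trans (count-∷-∈ (G ∷ L) x∈G′) (cong suc (count-∷-∈ L x∈G′))) (oc x)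
  ...   | inj₂ odd = odd

  oddCounts-drop-pair : ∀ G L → OddCounts (G ∷ G ∷ L) → OddCounts L
  oddCounts-drop-pair G L oc x with mem x G in x∈G
  ... | true  = inj₂ (count-odd-under-pair G L oc x (subst T (sym x∈G) tt))
  ... | false = subst ZeroOrOdd (≡-trans (count-∷-∉ (G ∷ L) x∈G) (count-∷-∉ L x∈G)) (oc x)

  constant-if-unique : ∀ {𝓖} → OddSunflowerFree 𝓖 → ∀ {L} → Unique L → All 𝓖 L → All Nonempty L →
    OddCounts L → Constant L × ZeroOrOdd (length L)
  constant-if-unique osf {[]}        _ _  _  _  = (λ ()) , inj₁ refl
  constant-if-unique osf {A ∷ []}    _ _  _  _  = (λ { (here refl) (here refl) → refl }) , inj₂ refl
  constant-if-unique osf {A ∷ B ∷ L} u gs ns oc = ⊥-elim (osf _ u gs (s≤s (s≤s z≤n) , ns , oc))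

  antichain-⊆⇒≡ : DecidableEquality S → ∀ {𝓖} → Antichain 𝓖 →
    ∀ {A B} → 𝓖 A → 𝓖 B → A ⊆ B → A ≡ B
  antichain-⊆⇒≡ _≟_ ac {A} {B} 𝓖A 𝓖B A⊆B with A ≟ B
  ... | yes A≡B = A≡B
  ... | no  A≢B = ⊥-elim (ac A B 𝓖A 𝓖B (A⊆B , A≢B))

  module _ (_≟_ : DecidableEquality S) where
    open DecMembership _≟_ using (_∈?_)

    ∈⇒↭ : ∀ {A : S} {L} → A ∈ L → ∃ λ L′ → L ↭ A ∷ L′
    ∈⇒↭ {A} A∈L with ys , zs , refl ← ∈-∃++ A∈L = _ , shift A ys zs

    unique-or-duplicate : ∀ L → Unique L ⊎ ∃₂ λ G L′ → L ↭ G ∷ G ∷ L′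
    unique-or-duplicate []      = inj₁ []
    unique-or-duplicate (A ∷ L) with A ∈? L
    ... | yes A∈L = let L′ , p = ∈⇒↭ A∈L in inj₂ (A , L′ , prep A p)
    ... | no  A∉L with unique-or-duplicate L
    ...   | inj₁ u            = inj₁ (¬Any⇒All¬ L A∉L ∷ u)
    ...   | inj₂ (G , L′ , p) =
      inj₂ (G , A ∷ L′ , trans (prep A p) (trans (swap A G ↭-refl) (prep G (swap A G ↭-refl))))

    constant-prepend-pair : ∀ {𝓖} → Antichain 𝓖 → ∀ {G L} → All 𝓖 (G ∷ G ∷ L) → Nonempty G →
      OddCounts (G ∷ G ∷ L) → Constant L × ZeroOrOdd (length L) →
      Constant (G ∷ G ∷ L) × ZeroOrOdd (length (G ∷ G ∷ L))
    constant-prepend-pair ac {G} {L} (𝓖G ∷ _ ∷ gs) (x₀ , x₀∈G) oc (const , len) = all-equal , len′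
      where
      coveredIn-L : ∀ y → T (mem y G) → ∃ λ H → H ∈ L × T (mem y H)
      coveredIn-L y y∈G = covered-if-count≢0 y L (odd⇒≢0 (count-odd-under-pair G L oc y y∈G))
        where
        odd⇒≢0 : ∀ {c} → c % 2 ≡ 1 → c ≢ 0
        odd⇒≢0 {suc _} _ ()

      H = proj₁ (coveredIn-L x₀ x₀∈G)
      H∈L = proj₁ (proj₂ (coveredIn-L x₀ x₀∈G))

      G⊆H : G ⊆ H
      G⊆H y y∈G with coveredIn-L y y∈G
      ... | H′ , H′∈L , y∈H′ = subst (λ A → T (mem y A)) (const H′∈L H∈L) y∈H′

      G≡H : G ≡ H
      G≡H = antichain-⊆⇒≡ _≟_ ac 𝓖G (All.lookup gs H∈L) G⊆H

      member≡G : ∀ {A} → A ∈ G ∷ G ∷ L → A ≡ G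
      member≡G (here refl)         = refl
      member≡G (there (here refl)) = refl
      member≡G (there (there A∈L)) = ≡-trans (const A∈L H∈L) (sym G≡H)

      all-equal : Constant (G ∷ G ∷ L)
      all-equal A∈ B∈ = ≡-trans (member≡G A∈) (sym (member≡G B∈))

      len′ : ZeroOrOdd (length (G ∷ G ∷ L))
      len′ = [ (λ ℓ≡0 → ⊥-elim (∈⇒length≢0 H∈L ℓ≡0)) , inj₂ ]′ len
        where
        ∈⇒length≢0 : ∀ {A : S} {L} → A ∈ L → length L ≢ 0
        ∈⇒length≢0 (here _)  ()
        ∈⇒length≢0 (there _) ()

    constant-if-oddCounts : ∀ {𝓖} → OddSunflowerFree 𝓖 → Antichain 𝓖 →
      ∀ L → All 𝓖 L → All Nonempty L → OddCounts L → Constant L × ZeroOrOdd (length L)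
    constant-if-oddCounts {𝓖} osf ac L = go L (<-wellFounded (length L))
      where
      go : ∀ L → Acc _<_ (length L) → All 𝓖 L → All Nonempty L → OddCounts L →
        Constant L × ZeroOrOdd (length L)
      go L (acc shorter) gs ns oc with unique-or-duplicate L
      ... | inj₁ u = constant-if-unique osf u gs ns oc
      ... | inj₂ (G , L′ , p) = from-↭ (constant-prepend-pair ac gs′ ns-head oc′ ih)
        where
        gs′ = All-resp-↭ p gs
        ns-head = All.head (All-resp-↭ p ns)
        oc′ = oddCounts-resp-↭ p oc

        L′<L : length L′ < length L
        L′<L = subst (length L′ <_) (sym (↭-length p)) (m<n⇒m<1+n (n<1+n _))

        ih : Constant L′ × ZeroOrOdd (length L′)
        ih = go L′ (shorter L′<L) (All.tail (All.tail gs′))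
               (All.tail (All.tail (All-resp-↭ p ns))) (oddCounts-drop-pair G L′ oc′)

        from-↭ : Constant (G ∷ G ∷ L′) × ZeroOrOdd (length (G ∷ G ∷ L′)) →
          Constant L × ZeroOrOdd (length L)
        from-↭ (const , len) = constant-resp-↭ (↭-sym p) const , subst ZeroOrOdd (sym (↭-length p)) len

_≟ˢ_ : ∀ {m} → DecidableEquality (Subset m)
_≟ˢ_ = ≡-dec _≟ᴮ_

≢emptySet⇒Nonempty : ∀ {m} {A : Subset m} → A ≢ emptySet → Generic.Nonempty memFin A
≢emptySet⇒Nonempty {A = []}        A≢∅ = ⊥-elim (A≢∅ refl)
≢emptySet⇒Nonempty {A = true ∷ A}  _   = zero , tt
≢emptySet⇒Nonempty {A = false ∷ A} A≢∅ with ≢emptySet⇒Nonempty (λ A≡∅ → A≢∅ (cong (false ∷_) A≡∅))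
... | j , j∈A = suc j , j∈A

module _ {m : ℕ} where
  open Generic (memFin {m})

  ∉emptySet : ∀ j → ¬ T (memFin j (emptySet {m}))
  ∉emptySet j j∈∅ = subst T (lookup-replicate j false) j∈∅

  Nonempty⇒≢emptySet : ∀ {A} → Nonempty A → A ≢ emptySet
  Nonempty⇒≢emptySet (j , j∈A) refl = ∉emptySet j j∈A

  antichain∋emptySet⇒≡emptySet : ∀ {𝓖} → Antichain 𝓖 → 𝓖 emptySet → ∀ {A} → 𝓖 A → A ≡ emptySet
  antichain∋emptySet⇒≡emptySet ac 𝓖∅ 𝓖A =
    sym (Families.antichain-⊆⇒≡ memFin _≟ˢ_ ac 𝓖∅ 𝓖A (λ j j∈∅ → ⊥-elim (∉emptySet j j∈∅)))

module _ {n m : ℕ} where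
  private
    module Base  = Generic (memFin {n})
    module Fibre = Generic (memFin {m})
    module Wr    = Generic (memW {n} {m})

  occupied : Subset m → Bool
  occupied v = isNo (v ≟ˢ emptySet)

  occupied⇒Nonempty : ∀ {v} → T (occupied v) → Fibre.Nonempty v
  occupied⇒Nonempty {v} occ with v ≟ˢ emptySet
  ... | no v≢∅ = ≢emptySet⇒Nonempty v≢∅

  Nonempty⇒occupied : ∀ {v} → Fibre.Nonempty v → T (occupied v)
  Nonempty⇒occupied {v} ne with v ≟ˢ emptySet
  ... | yes v≡∅ = Nonempty⇒≢emptySet ne v≡∅
  ... | no  _   = tt

  support : WSet n m → Subset n
  support A = tabulate (λ i → occupied (lookup A i))

  lookup-support : ∀ A i → lookup (support A) i ≡ occupied (lookup A i)
  lookup-support A i = lookup∘tabulate _ i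

  support-nonempty : ∀ {A} → Wr.Nonempty A → Base.Nonempty (support A)
  support-nonempty {A} ((i , j) , j∈Aᵢ) =
    i , subst T (sym (lookup-support A i)) (Nonempty⇒occupied (j , j∈Aᵢ))

  support-mono : ∀ {A B} → A Wr.⊆ B → support A Base.⊆ support B
  support-mono {A} {B} A⊆B i i∈sA with occupied⇒Nonempty (subst T (lookup-support A i) i∈sA)
  ... | j , j∈Aᵢ = subst T (sym (lookup-support B i)) (Nonempty⇒occupied (j , A⊆B (i , j) j∈Aᵢ))

  fibres-agree⇒≡ : ∀ {A B} → support A ≡ support B →
    (∀ i → lookup A i ≢ emptySet → lookup B i ≢ emptySet → lookup A i ≡ lookup B i) → A ≡ B
  fibres-agree⇒≡ {A} {B} sA≡sB agree = lookup-ext fibre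
    where
    same-occupancy : ∀ i → occupied (lookup A i) ≡ occupied (lookup B i)
    same-occupancy i =
      ≡-trans (sym (lookup-support A i)) (≡-trans (cong (λ F → lookup F i) sA≡sB) (lookup-support B i))

    fibre : ∀ i → lookup A i ≡ lookup B i
    fibre i with lookup A i ≟ˢ emptySet | lookup B i ≟ˢ emptySet | same-occupancy i
    ... | yes Aᵢ≡∅ | yes Bᵢ≡∅ | _  = ≡-trans Aᵢ≡∅ (sym Bᵢ≡∅)
    ... | no  Aᵢ≢∅ | no  Bᵢ≢∅ | _  = agree i Aᵢ≢∅ Bᵢ≢∅
    ... | yes _    | no  _    | ()
    ... | no  _    | yes _    | ()

  trace : Fin n → List (WSet n m) → List (Subset m)
  trace i []      = []
  trace i (A ∷ L) with lookup A i ≟ˢ emptySet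
  ... | yes _ = trace i L
  ... | no  _ = lookup A i ∷ trace i L

  count-support : ∀ i L → Base.count i (map support L) ≡ length (trace i L)
  count-support i []      = refl
  count-support i (A ∷ L) rewrite lookup-support A i with lookup A i ≟ˢ emptySet
  ... | yes _ = count-support i L
  ... | no  _ = cong suc (count-support i L)

  count-trace : ∀ i j L → Wr.count (i , j) L ≡ Fibre.count j (trace i L)
  count-trace i j []      = refl
  count-trace i j (A ∷ L) with lookup A i ≟ˢ emptySet
  ... | yes Aᵢ≡∅ = ≡-trans (Families.count-∷-∉ memW {A = A} L j∉Aᵢ) (count-trace i j L)
    where
    j∉Aᵢ : memW (i , j) A ≡ false
    j∉Aᵢ = ≡-trans (cong (λ v → lookup v j) Aᵢ≡∅) (lookup-replicate j false)
  ... | no _ with lookup (lookup A i) j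
  ...   | true  = cong suc (count-trace i j L)
  ...   | false = count-trace i j L

  ∈-trace : ∀ i {A L} → A ∈ L → lookup A i ≢ emptySet → lookup A i ∈ trace i L
  ∈-trace i {L = B ∷ L} (here refl) Aᵢ≢∅ with lookup B i ≟ˢ emptySet
  ... | yes Aᵢ≡∅ = ⊥-elim (Aᵢ≢∅ Aᵢ≡∅)
  ... | no  _    = here refl
  ∈-trace i {L = B ∷ L} (there A∈L) Aᵢ≢∅ with lookup B i ≟ˢ emptySet
  ... | yes _ = ∈-trace i A∈L Aᵢ≢∅
  ... | no  _ = there (∈-trace i A∈L Aᵢ≢∅)

  All-trace : ∀ {P : WSet n m → Set} {Q : Subset m → Set} i →
    (∀ {A} → P A → lookup A i ≢ emptySet → Q (lookup A i)) → ∀ {L} → All P L → All Q (trace i L)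
  All-trace i f []                = []
  All-trace i f {A ∷ L} (pA ∷ ps) with lookup A i ≟ˢ emptySet
  ... | yes _    = All-trace i f ps
  ... | no  Aᵢ≢∅ = f pA Aᵢ≢∅ ∷ All-trace i f ps

  support-isOddSunflower : ∀ {L} → (∀ i → ZeroOrOdd (length (trace i L))) →
    Wr.IsOddSunflower L → Base.IsOddSunflower (map support L)
  support-isOddSunflower {L} traces-odd (2≤∣L∣ , ns , _) =
    subst (2 ≤_) (sym (length-map support L)) 2≤∣L∣ ,
    Allₚ.map⁺ (All.map (λ {A} → support-nonempty {A = A}) ns) ,
    λ i → subst ZeroOrOdd (sym (count-support i L)) (traces-odd i)

  support-injectiveOn : ∀ {L} → (∀ i → Families.Constant memFin (trace i L)) →
    ∀ {A B} → A ∈ L → B ∈ L → support A ≡ support B → A ≡ B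
  support-injectiveOn const A∈L B∈L sA≡sB = fibres-agree⇒≡ sA≡sB λ i Aᵢ≢∅ Bᵢ≢∅ →
    const i (∈-trace i A∈L Aᵢ≢∅) (∈-trace i B∈L Bᵢ≢∅)

  module _ {𝓕 : Subset n → Set} {𝓖 : Subset m → Set} where

    wreath-occupied : ∀ {A} → Wreath 𝓕 𝓖 A → ∀ {i} → lookup A i ≢ emptySet → 𝓖 (lookup A i)
    wreath-occupied (F₀ , _ , fibres) {i} Aᵢ≢∅ with T? (lookup F₀ i)
    ... | yes i∈F₀ = proj₁ (fibres i) i∈F₀
    ... | no  i∉F₀ = ⊥-elim (Aᵢ≢∅ (proj₂ (fibres i) i∉F₀))

    wreath-emptyFibres : Fibre.Antichain 𝓖 → 𝓖 emptySet → ∀ {A} → Wreath 𝓕 𝓖 A →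
      ∀ i → lookup A i ≡ emptySet
    wreath-emptyFibres acG 𝓖∅ {A} w i with lookup A i ≟ˢ emptySet
    ... | yes Aᵢ≡∅ = Aᵢ≡∅
    ... | no  Aᵢ≢∅ = antichain∋emptySet⇒≡emptySet acG 𝓖∅ (wreath-occupied {A} w Aᵢ≢∅)

    wreath-support : ¬ 𝓖 emptySet → ∀ {A} → Wreath 𝓕 𝓖 A → 𝓕 (support A)
    wreath-support ∅∉𝓖 {A} (F₀ , 𝓕F₀ , fibres) = subst 𝓕 (lookup-ext F₀≗support) 𝓕F₀
      where
      F₀≗support : ∀ i → lookup F₀ i ≡ lookup (support A) i
      F₀≗support i rewrite lookup-support A i with lookup F₀ i in i∈F₀ | lookup A i ≟ˢ emptySet
      ... | true  | no  _    = refl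
      ... | false | yes _    = refl
      ... | true  | yes Aᵢ≡∅ = ⊥-elim (∅∉𝓖 (subst 𝓖 Aᵢ≡∅ (proj₁ (fibres i) (subst T (sym i∈F₀) tt))))
      ... | false | no  Aᵢ≢∅ = ⊥-elim (Aᵢ≢∅ (proj₂ (fibres i) (subst T i∈F₀)))

    wreath-¬Nonempty : Fibre.Antichain 𝓖 → 𝓖 emptySet → ∀ {A} → Wreath 𝓕 𝓖 A → ¬ Wr.Nonempty A
    wreath-¬Nonempty acG 𝓖∅ {A} w ((i , j) , j∈Aᵢ) =
      ∉emptySet j (subst (λ v → T (lookup v j)) (wreath-emptyFibres acG 𝓖∅ {A} w i) j∈Aᵢ)

    traces-constant : Fibre.OddSunflowerFree 𝓖 → Fibre.Antichain 𝓖 →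
      ∀ {L} → All (Wreath 𝓕 𝓖) L → Families.OddCounts memW L →
      ∀ i → Families.Constant memFin (trace i L) × ZeroOrOdd (length (trace i L))
    traces-constant osfG acG {L} ws oc i =
      Families.constant-if-oddCounts memFin _≟ˢ_ osfG acG (trace i L)
        (All-trace i (λ {A} w → wreath-occupied {A} w) ws)
        (All-trace i (λ _ Aᵢ≢∅ → ≢emptySet⇒Nonempty Aᵢ≢∅) ws)
        (λ j → subst ZeroOrOdd (count-trace i j L) (oc (i , j)))

    wreath-oddSunflowerFree : Base.OddSunflowerFree 𝓕 → Fibre.OddSunflowerFree 𝓖 →
      Fibre.Antichain 𝓖 → Wr.OddSunflowerFree (Wreath 𝓕 𝓖)
    wreath-oddSunflowerFree osfF osfG acG []          _ _          (() , _)
    wreath-oddSunflowerFree osfF osfG acG L@(A ∷ _) u ws@(wA ∷ _) sf@(_ , neA ∷ _ , oc) =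
      ¬¬-excluded-middle λ
        { (yes 𝓖∅)  → wreath-¬Nonempty acG 𝓖∅ {A} wA neA
        ; (no ∅∉𝓖) → osfF (map support L)
            (map⁺-injectiveOn (support-injectiveOn (λ i → proj₁ (traces i))) u)
            (Allₚ.map⁺ (All.map (λ {B} → wreath-support ∅∉𝓖 {B}) ws))
            (support-isOddSunflower (λ i → proj₂ (traces i)) sf) }
      where
      traces = traces-constant osfG acG ws oc

    wreath-⊆⇒≡ : ¬ 𝓖 emptySet → Base.Antichain 𝓕 → Fibre.Antichain 𝓖 →
      ∀ {A B} → Wreath 𝓕 𝓖 A → Wreath 𝓕 𝓖 B → A Wr.⊆ B → A ≡ B
    wreath-⊆⇒≡ ∅∉𝓖 acF acG {A} {B} wA wB A⊆B = fibres-agree⇒≡ sA≡sB λ i Aᵢ≢∅ Bᵢ≢∅ →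
      Families.antichain-⊆⇒≡ memFin _≟ˢ_ acG
        (wreath-occupied {A} wA Aᵢ≢∅) (wreath-occupied {B} wB Bᵢ≢∅) (λ j → A⊆B (i , j))
      where
      sA≡sB : support A ≡ support B
      sA≡sB = Families.antichain-⊆⇒≡ memFin _≟ˢ_ acF
        (wreath-support ∅∉𝓖 {A} wA) (wreath-support ∅∉𝓖 {B} wB) (support-mono {A = A} {B = B} A⊆B)

    wreath-antichain : Base.Antichain 𝓕 → Fibre.Antichain 𝓖 → Wr.Antichain (Wreath 𝓕 𝓖)
    wreath-antichain acF acG A B wA wB (A⊆B , A≢B) = ¬¬-excluded-middle λ
      { (yes 𝓖∅)  → A≢B (lookup-ext λ i →
          ≡-trans (wreath-emptyFibres acG 𝓖∅ {A} wA i) (sym (wreath-emptyFibres acG 𝓖∅ {B} wB i)))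
      ; (no ∅∉𝓖) → A≢B (wreath-⊆⇒≡ ∅∉𝓖 acF acG {A} {B} wA wB A⊆B) }

lemma6 : (n m : ℕ) (𝓕 : Subset n → Set) (𝓖 : Subset m → Set) →
    Generic.OddSunflowerFree memFin 𝓕 →
    Generic.OddSunflowerFree memFin 𝓖 →
    Generic.Antichain memFin 𝓖 →
    Generic.OddSunflowerFree (memW {n} {m}) (Wreath 𝓕 𝓖)
      × (Generic.Antichain memFin 𝓕 → Generic.Antichain (memW {n} {m}) (Wreath 𝓕 𝓖))
lemma6 n m 𝓕 𝓖 osfF osfG acG =
  wreath-oddSunflowerFree osfF osfG acG , λ acF → wreath-antichain acF acG
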